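{- Let $M$ and $N$ be $q$-matroids on the same finite-dimensional vector space $V$, with rank functions $r_M$ and $r_N$. If the union $M\vee N$ has the same rank as $M$ (i.e. the rank of $V$ in $M\vee N$ equals $r_M(V)$), then $M\vee N=M$.
   Context: A $q$-matroid on $V$ is given by a rank function $r$ on subspaces of $V$ with $0\le r(A)\le\dim A$, $A\le B\Rightarrow r(A)\le r(B)$, and $r(A+B)+r(A\cap B)\le r(A)+r(B)$; $A\le B$ means $A$ is a subspace of $B$. A subspace $A$ is independent if $r(A)=\dim A$. The union $M\vee N$ is the $q$-matroid induced by $f=r_M+r_N$: a subspace $A$ is independent in $M\vee N$ iff $f(B)\ge\dim B$ for all subspaces $B\le A$, and its rank function is $r(A)=\min_{B\le A}\bigl(f(B)+\dim A-\dim B\bigr)$. Two $q$-matroids on $V$ are equal if they have the same independent subspaces (equivalently the same rank function). -}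

module Defs where

open import Level using (Level; _⊔_) renaming (suc to lsuc)
open import Algebra.Bundles using (CommutativeRing)
open import Data.Nat using (ℕ; zero; suc; _+_; _∸_; _≤_)
open import Data.Fin using (Fin; zero; suc)
open import Data.Product using (Σ; ∃; ∃-syntax; _×_; _,_)
open import Relation.Nullary using (¬_)
open import Relation.Binary.PropositionalEquality using (_≡_)
open import Function.Bundles using (_⇔_)

record Field (c ℓ : Level) : Set (lsuc (c ⊔ ℓ)) where
  field
    commRing : CommutativeRing c ℓ
  open CommutativeRing commRing public
  field
    0≉1 : ¬ (0# ≈ 1#)
    inverse : ∀ x → ¬ (x ≈ 0#) → ∃[ y ] (x * y ≈ 1#)

FiniteField : ∀ {c ℓ} → Field c ℓ → Set (c ⊔ ℓ)
FiniteField F = Σ ℕ λ q → Σ (Fin q → Carrier) λ e → ∀ x → ∃[ i ] (e i ≈ x)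
  where open Field F

module LinAlg {c ℓ : Level} (F : Field c ℓ) (n : ℕ) where
  open Field F using (Carrier; 0#) renaming (_≈_ to _≈F_; _+_ to _+F_; _*_ to _*F_)

  Vect : Set c
  Vect = Fin n → Carrier

  _≈ᵥ_ : Vect → Vect → Set ℓ
  u ≈ᵥ v = ∀ i → u i ≈F v i

  0ᵥ : Vect
  0ᵥ _ = 0#

  _+ᵥ_ : Vect → Vect → Vect
  (u +ᵥ v) i = u i +F v i

  _·ᵥ_ : Carrier → Vect → Vect
  (a ·ᵥ v) i = a *F v i

  lincomb : ∀ {d} → (Fin d → Vect) → (Fin d → Carrier) → Vect
  lincomb {zero} b cs = 0ᵥ
  lincomb {suc d} b cs = (cs zero ·ᵥ b zero) +ᵥ lincomb (λ i → b (suc i)) (λ i → cs (suc i))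

  record Subspace : Set (lsuc (c ⊔ ℓ)) where
    field
      mem : Vect → Set (c ⊔ ℓ)
      mem-resp : ∀ {u v} → u ≈ᵥ v → mem u → mem v
      mem-0 : mem 0ᵥ
      mem-+ : ∀ {u v} → mem u → mem v → mem (u +ᵥ v)
      mem-· : ∀ a {v} → mem v → mem (a ·ᵥ v)
      dim : ℕ
      basis : Fin dim → Vect
      basis-mem : ∀ i → mem (basis i)
      basis-indep : ∀ cs → lincomb basis cs ≈ᵥ 0ᵥ → ∀ i → cs i ≈F 0#
      basis-span : ∀ v → mem v → ∃[ cs ] (v ≈ᵥ lincomb basis cs)
  open Subspace public

  _≤S_ : Subspace → Subspace → Set (c ⊔ ℓ)
  A ≤S B = ∀ v → mem A v → mem B v

  _≅S_ : Subspace → Subspace → Set (c ⊔ ℓ)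
  A ≅S B = (A ≤S B) × (B ≤S A)

  IsSum : Subspace → Subspace → Subspace → Set (c ⊔ ℓ)
  IsSum S A B = ∀ v → mem S v ⇔ (∃[ a ] ∃[ b ] (mem A a × mem B b × v ≈ᵥ (a +ᵥ b)))

  IsMeet : Subspace → Subspace → Subspace → Set (c ⊔ ℓ)
  IsMeet I A B = ∀ v → mem I v ⇔ (mem A v × mem B v)

  IsWhole : Subspace → Set (c ⊔ ℓ)
  IsWhole A = ∀ v → mem A v

  record QMatroid : Set (lsuc (c ⊔ ℓ)) where
    field
      r : Subspace → ℕ
      r-resp : ∀ {A B} → A ≅S B → r A ≡ r B
      r-dim : ∀ A → r A ≤ dim A
      r-mono : ∀ {A B} → A ≤S B → r A ≤ r B
      r-submod : ∀ {S I A B} → IsSum S A B → IsMeet I A B → r S + r I ≤ r A + r B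
  open QMatroid public

  Independent : QMatroid → Subspace → Set
  Independent M A = r M A ≡ dim A

  -- independent subspaces of the union M ∨ N (induced by f = r_M + r_N)
  UnionIndependent : QMatroid → QMatroid → Subspace → Set (lsuc (c ⊔ ℓ))
  UnionIndependent M N A = ∀ B → B ≤S A → dim B ≤ r M B + r N B

  IsUnionRank : QMatroid → QMatroid → Subspace → ℕ → Set (lsuc (c ⊔ ℓ))
  IsUnionRank M N A k =
    (∃[ B ] (B ≤S A × k ≡ r M B + r N B + (dim A ∸ dim B)))
    × (∀ B → B ≤S A → k ≤ r M B + r N B + (dim A ∸ dim B))

  rk : QMatroid → Subspace → ℕ
  rk M A = r M A

-- Choose B₀ attaining the rank of V in M ∨ N, so r_M(V) = r_M(B₀) + r_N(B₀) + dim V − dim B₀.  For A independent in M ∨ N put S = A + B₀ and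
-- D = A ∩ B₀.  Then
--   dim A + dim B₀ = dim S + dim D                  (Grassmann),
--   dim D ≤ r_M(D) + r_N(D) ≤ r_M(D) + r_N(B₀)      (A is independent in M ∨ N),
--   r_M(V) − r_M(S) ≤ dim V − dim S                 (rank grows at most as fast as dimension),
--   r_M(S) + r_M(D) ≤ r_M(A) + r_M(B₀)              (submodularity),
-- and adding these up gives dim A ≤ r_M(A).  Conversely, the same growth bound makes every subspace of
-- an M-independent space M-independent, hence independent in M ∨ N.
--
-- The linear algebra behind Grassmann's formula (Steinitz exchange, bases of intersections and of
-- complements) searches exhaustively over coefficient vectors, so it needs decidable equality on the
-- finite field.  Constructively that holds only up to double negation, which is enough because both
-- conclusions are decidable statements about ℕ.

{-# OPTIONS --safe #-}
module Submission where

open import Defs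
open import Level using (Level; _⊔_)
open import Data.Nat as ℕ using (ℕ; zero; suc; s≤s)
import Data.Nat.Properties as ℕₚ
open import Data.Fin using (Fin; zero; suc; punchIn; splitAt; join; _↑ˡ_; _↑ʳ_)
import Data.Fin.Properties as Fin
open import Data.Empty using (⊥-elim)
open import Data.Product using (∃; ∃-syntax; _×_; _,_; proj₁; proj₂)
open import Data.Sum using (inj₁; inj₂; [_,_])
import Relation.Binary.Bundles
open import Relation.Nullary using (¬_; Dec; yes; no)
open import Relation.Nullary.Decidable using (map′; decidable-stable; ¬?; _×-dec_; ¬¬-excluded-middle)
open import Relation.Nullary.Negation using (¬¬-map)
open import Relation.Binary.Definitions using (Decidable)
open import Relation.Binary.PropositionalEquality as ≡ using (_≡_; _≗_)
open import Function.Bundles using (_⇔_; mk⇔; Equivalence)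
open import Function using (_∘_; _∘′_)

module _ {a} {A : Set a} where
  open import Data.Vec.Functional using (Vector; _∷_; tail; _++_)

  tail-++ : ∀ {k m} (xs : Vector A (suc k)) (ys : Vector A m) → tail (xs ++ ys) ≗ tail xs ++ ys
  tail-++ {k} xs ys i with splitAt k i
  ... | inj₁ _ = ≡.refl
  ... | inj₂ _ = ≡.refl

  ∷-++ : ∀ {k m} x (xs : Vector A k) (ys : Vector A m) → (x ∷ xs) ++ ys ≗ x ∷ (xs ++ ys)
  ∷-++ x xs ys zero = ≡.refl
  ∷-++ x xs ys (suc i) = tail-++ (x ∷ xs) ys i

  module _ {p} (P : A → Set p) where

    ++-all : ∀ {k m} {xs : Vector A k} {ys : Vector A m} →
             (∀ i → P (xs i)) → (∀ i → P (ys i)) → ∀ i → P ((xs ++ ys) i)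
    ++-all {k} {xs = xs} {ys} pxs pys i = [_,_] {C = λ s → P ([ xs , ys ] s)} pxs pys (splitAt k i)

∀-splitAt : ∀ k {m p} (P : Fin (k ℕ.+ m) → Set p) → (∀ j → P (j ↑ˡ m)) → (∀ j → P (k ↑ʳ j)) → ∀ i → P i
∀-splitAt k {m} P pl pr i =
  ≡.subst P (Fin.join-splitAt k m i) ([_,_] {C = λ s → P (join k m s)} pl pr (splitAt k i))

∀-punchIn : ∀ {k p} (P : Fin (suc k) → Set p) i → P i → (∀ j → P (punchIn i j)) → ∀ j → P j
∀-punchIn P i pi pj j with i Fin.≟ j
... | yes ≡.refl = pi
... | no i≢j = ≡.subst P (Fin.punchIn-punchOut i≢j) (pj _)

module HomogeneousSystem {c ℓ} (F : Field c ℓ) (_≈?_ : Decidable (Field._≈_ F)) where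
  open import Data.Vec.Functional using (Vector; _∷_; tail)
  open Field F hiding (zero)
  open import Algebra.Properties.Semiring.Sum semiring
    using (sum-cong-≋; sum-replicate-zero; ∑-distrib-+; *-distribˡ-sum) renaming (sum to ∑)
  open import Algebra.Properties.Ring ring using (-‿distribˡ-*; -‿distribʳ-*)
  open import Relation.Binary.Reasoning.Setoid setoid

  infix 7 _·_
  _·_ : ∀ {m} → Vector Carrier m → Vector Carrier m → Carrier
  u · x = ∑ (λ j → u j * x j)

  ·-linearˡ : ∀ {m} (u v x : Vector Carrier m) a → (λ j → u j + a * v j) · x ≈ u · x + a * (v · x)
  ·-linearˡ u v x a = begin
    ∑ (λ j → (u j + a * v j) * x j)       ≈⟨ sum-cong-≋ (λ j → trans (distribʳ (x j) (u j) (a * v j))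
                                                                     (+-congˡ (*-assoc a (v j) (x j)))) ⟩
    ∑ (λ j → u j * x j + a * (v j * x j)) ≈⟨ ∑-distrib-+ (λ j → u j * x j) (λ j → a * (v j * x j)) ⟩
    u · x + ∑ (λ j → a * (v j * x j))     ≈⟨ +-congˡ (*-distribˡ-sum a (λ j → v j * x j)) ⟨
    u · x + a * (v · x)                   ∎

  x*-yz≈-xy*z : ∀ x y z → x * - (y * z) ≈ - (x * y) * z
  x*-yz≈-xy*z x y z = begin
    x * - (y * z)   ≈⟨ -‿distribʳ-* x (y * z) ⟨
    - (x * (y * z)) ≈⟨ -‿cong (*-assoc x y z) ⟨
    - (x * y * z)   ≈⟨ -‿distribˡ-* (x * y) z ⟩
    - (x * y) * z   ∎

  1≉0 : ¬ 1# ≈ 0#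
  1≉0 = 0≉1 ∘′ sym

  NontrivialSolution : ∀ {d m} → (Fin d → Vector Carrier m) → Set (c ⊔ ℓ)
  NontrivialSolution A = ∃[ x ] (∃[ j ] ¬ x j ≈ 0#) × (∀ k → A k · x ≈ 0#)

  fewer-equations⇒nontrivial-solution : ∀ {d m} → d ℕ.< m → (A : Fin d → Vector Carrier m) → NontrivialSolution A
  fewer-equations⇒nontrivial-solution {zero} {suc m} _ A = (λ _ → 1#) , (zero , 1≉0) , λ ()
  fewer-equations⇒nontrivial-solution {suc d} {suc m} (s≤s d<m) A with Fin.any? (λ k → ¬? (A k zero ≈? 0#))
  ... | no no-pivot = e₀ , (zero , 1≉0) , e₀-solves
    where
      e₀ : Vector Carrier (suc m)
      e₀ = 1# ∷ λ _ → 0#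
      e₀-solves : ∀ k → A k · e₀ ≈ 0#
      e₀-solves k = begin
        A k zero * 1# + ∑ (λ j → A k (suc j) * 0#) ≈⟨ +-cong (trans (*-identityʳ _) first-column-zero)
                                                             (trans (sum-cong-≋ (λ j → zeroʳ (A k (suc j))))
                                                                    (sum-replicate-zero m)) ⟩
        0# + 0#                                    ≈⟨ +-identityˡ 0# ⟩
        0#                                         ∎
        where
          first-column-zero : A k zero ≈ 0#
          first-column-zero = decidable-stable (A k zero ≈? 0#) (λ ≉0 → no-pivot (k , ≉0))
  ... | yes (k₀ , p≉0) = lift (fewer-equations⇒nontrivial-solution d<m reduced)
    where
      p⁻¹ : Carrier
      p⁻¹ = proj₁ (inverse (A k₀ zero) p≉0)
      -- Subtracting multiples of the pivot row k₀ from the other rows clears their first column.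
      reduced : Fin d → Vector Carrier m
      reduced k j = A (punchIn k₀ k) (suc j) + - (A (punchIn k₀ k) zero * p⁻¹) * A k₀ (suc j)
      lift : NontrivialSolution reduced → NontrivialSolution A
      lift (y , (j , yⱼ≉0) , y-solves) = x , (suc j , yⱼ≉0) , ∀-punchIn (λ k → A k · x ≈ 0#) k₀ pivot-row other-row
        where
          T : Carrier
          T = tail (A k₀) · y
          x : Vector Carrier (suc m)
          x = - (p⁻¹ * T) ∷ y
          pivot-row : A k₀ · x ≈ 0#
          pivot-row = begin
            A k₀ zero * - (p⁻¹ * T) + T   ≈⟨ +-congʳ (-‿distribʳ-* (A k₀ zero) (p⁻¹ * T)) ⟨
            - (A k₀ zero * (p⁻¹ * T)) + T ≈⟨ +-congʳ (-‿cong (*-assoc (A k₀ zero) p⁻¹ T)) ⟨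
            - (A k₀ zero * p⁻¹ * T) + T   ≈⟨ +-congʳ (-‿cong (trans (*-congʳ (proj₂ (inverse (A k₀ zero) p≉0)))
                                                                    (*-identityˡ T))) ⟩
            - T + T                       ≈⟨ -‿inverseˡ T ⟩
            0#                            ∎
          other-row : ∀ k → A (punchIn k₀ k) · x ≈ 0#
          other-row k = begin
            a * - (p⁻¹ * T) + tail Aₖ · y   ≈⟨ +-comm _ _ ⟩
            tail Aₖ · y + a * - (p⁻¹ * T)   ≈⟨ +-congˡ (x*-yz≈-xy*z a p⁻¹ T) ⟩
            tail Aₖ · y + - (a * p⁻¹) * T   ≈⟨ ·-linearˡ (tail Aₖ) (tail (A k₀)) y (- (a * p⁻¹)) ⟨
            reduced k · y                   ≈⟨ y-solves k ⟩
            0#                              ∎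
            where
              Aₖ : Vector Carrier (suc m)
              Aₖ = A (punchIn k₀ k)
              a : Carrier
              a = Aₖ zero

module LinearAlgebra {c ℓ} (F : Field c ℓ) (n : ℕ) where
  open Field F hiding (zero)
  open LinAlg F n
  open import Data.Vec.Functional using ([]; _∷_; tail; _++_; take; drop)
  open import Algebra.Properties.Ring ring using (-‿distribˡ-*; -‿distribʳ-*; -‿+-comm; -0#≈0#; +-inverseˡ-unique)
  open import Algebra.Properties.CommutativeSemigroup +-commutativeSemigroup using (interchange)
  import Data.Vec.Functional.Relation.Binary.Pointwise.Properties as Pointwise
  open import Data.Vec.Functional.Properties using (lookup-++ˡ; lookup-++ʳ)
  open import Algebra.Properties.CommutativeMonoid.Sum +-commutativeMonoid using () renaming (sum to ∑)
  open import Relation.Binary.Reasoning.Setoid setoid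
  module ≈ᵥ = Relation.Binary.Bundles.Setoid (Pointwise.setoid setoid n)

  lincomb-cong : ∀ {k} {w w′ : Fin k → Vect} {cs cs′ : Fin k → Carrier} →
                 (∀ j → w j ≈ᵥ w′ j) → (∀ j → cs j ≈ cs′ j) → lincomb w cs ≈ᵥ lincomb w′ cs′
  lincomb-cong {zero} w≈ cs≈ i = refl
  lincomb-cong {suc k} w≈ cs≈ i = +-cong (*-cong (cs≈ zero) (w≈ zero i)) (lincomb-cong (w≈ ∘ suc) (cs≈ ∘ suc) i)

  lincomb-zero : ∀ {k} (w : Fin k → Vect) → lincomb w (λ _ → 0#) ≈ᵥ 0ᵥ
  lincomb-zero {zero} w i = refl
  lincomb-zero {suc k} w i = trans (+-cong (zeroˡ (w zero i)) (lincomb-zero (tail w) i)) (+-identityˡ 0#)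

  lincomb-+ : ∀ {k} (w : Fin k → Vect) cs ds → lincomb w (λ j → cs j + ds j) ≈ᵥ (lincomb w cs +ᵥ lincomb w ds)
  lincomb-+ {zero} w cs ds i = sym (+-identityˡ 0#)
  lincomb-+ {suc k} w cs ds i = trans
    (+-cong (distribʳ (w zero i) (cs zero) (ds zero)) (lincomb-+ (tail w) (tail cs) (tail ds) i))
    (interchange _ _ _ _)

  lincomb-* : ∀ {k} (w : Fin k → Vect) a cs → lincomb w (λ j → a * cs j) ≈ᵥ (a ·ᵥ lincomb w cs)
  lincomb-* {zero} w a cs i = sym (zeroʳ a)
  lincomb-* {suc k} w a cs i =
    trans (+-cong (*-assoc a (cs zero) (w zero i)) (lincomb-* (tail w) a (tail cs) i)) (sym (distribˡ a _ _))

  lincomb-neg : ∀ {k} (w : Fin k → Vect) cs → lincomb w (λ j → - cs j) ≈ᵥ (λ i → - lincomb w cs i)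
  lincomb-neg {zero} w cs i = sym -0#≈0#
  lincomb-neg {suc k} w cs i =
    trans (+-cong (sym (-‿distribˡ-* (cs zero) (w zero i))) (lincomb-neg (tail w) (tail cs) i)) (-‿+-comm _ _)

  lincomb-++ : ∀ {k m} (u : Fin k → Vect) (w : Fin m → Vect) cs →
               lincomb (u ++ w) cs ≈ᵥ (lincomb u (take k cs) +ᵥ lincomb w (drop k cs))
  lincomb-++ {zero} u w cs i = sym (+-identityˡ _)
  lincomb-++ {suc k} u w cs i = begin
    cs zero * u zero i + lincomb (tail (u ++ w)) (tail cs) i
      ≈⟨ +-congˡ (lincomb-cong (≈ᵥ.reflexive ∘ tail-++ u w) (λ _ → refl) i) ⟩
    cs zero * u zero i + lincomb (tail u ++ w) (tail cs) i
      ≈⟨ +-congˡ (lincomb-++ (tail u) w (tail cs) i) ⟩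
    cs zero * u zero i + (lincomb (tail u) (take k (tail cs)) i + lincomb w (drop k (tail cs)) i)
      ≈⟨ +-assoc _ _ _ ⟨
    lincomb u (take (suc k) cs) i + lincomb w (drop (suc k) cs) i ∎

  lincomb-∘ : ∀ {m d} {w : Fin m → Vect} (v : Fin d → Vect) (C : Fin m → Fin d → Carrier) →
              (∀ j → w j ≈ᵥ lincomb v (C j)) → ∀ x → lincomb w x ≈ᵥ lincomb v (λ k → ∑ (λ j → C j k * x j))
  lincomb-∘ {zero} v C w≈ x i = sym (lincomb-zero v i)
  lincomb-∘ {suc m} v C w≈ x i = begin
    x zero * _ + lincomb _ (tail x) i
      ≈⟨ +-cong (*-congˡ (w≈ zero i)) (lincomb-∘ v (tail C) (w≈ ∘ suc) (tail x) i) ⟩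
    x zero * lincomb v (C zero) i + lincomb v (λ k → ∑ (λ j → C (suc j) k * x (suc j))) i
      ≈⟨ +-congʳ (lincomb-* v (x zero) (C zero) i) ⟨
    lincomb v (λ k → x zero * C zero k) i + lincomb v (λ k → ∑ (λ j → C (suc j) k * x (suc j))) i
      ≈⟨ lincomb-+ v _ _ i ⟨
    lincomb v (λ k → x zero * C zero k + ∑ (λ j → C (suc j) k * x (suc j))) i
      ≈⟨ lincomb-cong (λ _ → ≈ᵥ.refl) (λ k → +-congʳ (*-comm (x zero) (C zero k))) i ⟩
    lincomb v (λ k → ∑ (λ j → C j k * x j)) i ∎

  lincomb-++-++ : ∀ {k m} (u : Fin k → Vect) (w : Fin m → Vect) γ β →
                  lincomb (u ++ w) (γ ++ β) ≈ᵥ (lincomb u γ +ᵥ lincomb w β)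
  lincomb-++-++ u w γ β i = trans (lincomb-++ u w (γ ++ β) i)
    (+-cong (lincomb-cong (λ _ → ≈ᵥ.refl) (reflexive ∘ lookup-++ˡ γ β) i)
            (lincomb-cong (λ _ → ≈ᵥ.refl) (reflexive ∘ lookup-++ʳ γ β) i))

  Span : ∀ {k} → (Fin k → Vect) → Vect → Set (c ⊔ ℓ)
  Span w v = ∃[ cs ] v ≈ᵥ lincomb w cs

  LinearlyIndependent : ∀ {k} → (Fin k → Vect) → Set (c ⊔ ℓ)
  LinearlyIndependent w = ∀ cs → lincomb w cs ≈ᵥ 0ᵥ → ∀ j → cs j ≈ 0#

  LinearlyIndependent-resp : ∀ {k} {w w′ : Fin k → Vect} → (∀ j → w j ≈ᵥ w′ j) →
                             LinearlyIndependent w → LinearlyIndependent w′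
  LinearlyIndependent-resp w≈w′ w-indep cs w′cs≈0 = w-indep cs (≈ᵥ.trans (lincomb-cong w≈w′ (λ _ → refl)) w′cs≈0)

  module _ {k} {w : Fin k → Vect} where

    Span-resp : ∀ {u v} → u ≈ᵥ v → Span w u → Span w v
    Span-resp u≈v (cs , u≈) = cs , ≈ᵥ.trans (≈ᵥ.sym u≈v) u≈

    Span-0 : Span w 0ᵥ
    Span-0 = (λ _ → 0#) , ≈ᵥ.sym (lincomb-zero w)

    Span-+ : ∀ {u v} → Span w u → Span w v → Span w (u +ᵥ v)
    Span-+ (cs , u≈) (ds , v≈) =
      (λ j → cs j + ds j) , λ i → trans (+-cong (u≈ i) (v≈ i)) (sym (lincomb-+ w cs ds i))

    Span-· : ∀ a {v} → Span w v → Span w (a ·ᵥ v)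
    Span-· a (cs , v≈) = (λ j → a * cs j) , λ i → trans (*-congˡ (v≈ i)) (sym (lincomb-* w a cs i))

  Span-generator : ∀ {k} (w : Fin k → Vect) j → Span w (w j)
  Span-generator w zero = (1# ∷ λ _ → 0#) , λ i →
    sym (trans (+-cong (*-identityˡ (w zero i)) (lincomb-zero (tail w) i)) (+-identityʳ _))
  Span-generator w (suc j) with Span-generator (tail w) j
  ... | cs , w≈ = (0# ∷ cs) , λ i → trans (w≈ i) (sym (trans (+-congʳ (zeroˡ (w zero i))) (+-identityˡ _)))

  Span-++⁺ : ∀ {k m} {u : Fin k → Vect} {w : Fin m → Vect} {x y} →
             Span u x → Span w y → Span (u ++ w) (x +ᵥ y)
  Span-++⁺ {u = u} {w} (γ , x≈) (β , y≈) =
    (γ ++ β) , λ i → trans (+-cong (x≈ i) (y≈ i)) (sym (lincomb-++-++ u w γ β i))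

  Span-++⁻ : ∀ {k m} {u : Fin k → Vect} {w : Fin m → Vect} {v} → Span (u ++ w) v →
             ∃[ x ] ∃[ y ] (Span u x × Span w y × v ≈ᵥ (x +ᵥ y))
  Span-++⁻ {k} {u = u} {w} (cs , v≈) =
    _ , _ , (take k cs , ≈ᵥ.refl) , (drop k cs , ≈ᵥ.refl) , ≈ᵥ.trans v≈ (lincomb-++ u w cs)

  module _ (A : Subspace) where

    lincomb-mem : ∀ {k} {w : Fin k → Vect} → (∀ j → mem A (w j)) → ∀ cs → mem A (lincomb w cs)
    lincomb-mem {zero} w∈A cs = mem-0 A
    lincomb-mem {suc k} w∈A cs = mem-+ A (mem-· A (cs zero) (w∈A zero)) (lincomb-mem (w∈A ∘ suc) (tail cs))

    Span⊆mem : ∀ {k} {w : Fin k → Vect} → (∀ j → mem A (w j)) → ∀ {v} → Span w v → mem A v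
    Span⊆mem w∈A (cs , v≈) = mem-resp A (≈ᵥ.sym v≈) (lincomb-mem w∈A cs)

    Span-basis⊆mem : ∀ {v} → Span (basis A) v → mem A v
    Span-basis⊆mem = Span⊆mem (basis-mem A)

  span : ∀ {k} (w : Fin k → Vect) → LinearlyIndependent w → Subspace
  span {k} w w-indep = record
    { mem = Span w
    ; mem-resp = Span-resp
    ; mem-0 = Span-0
    ; mem-+ = Span-+
    ; mem-· = Span-·
    ; dim = k
    ; basis = w
    ; basis-mem = Span-generator w
    ; basis-indep = w-indep
    ; basis-span = λ _ v∈ → v∈
    }

  module _ {k m} {u : Fin k → Vect} {w : Fin m → Vect} where

    ++-independent⁻ : LinearlyIndependent (u ++ w) → ∀ γ β → lincomb u γ ≈ᵥ lincomb w β → ∀ j → γ j ≈ 0#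
    ++-independent⁻ indep γ β γ≈β j =
      trans (reflexive (≡.sym (lookup-++ˡ γ -β j))) (indep (γ ++ -β) zero-combination (j ↑ˡ m))
      where
        -β : Fin m → Carrier
        -β j = - β j
        zero-combination : lincomb (u ++ w) (γ ++ -β) ≈ᵥ 0ᵥ
        zero-combination i = begin
          lincomb (u ++ w) (γ ++ -β) i    ≈⟨ lincomb-++-++ u w γ -β i ⟩
          lincomb u γ i + lincomb w -β i  ≈⟨ +-cong (γ≈β i) (lincomb-neg w β i) ⟩
          lincomb w β i + - lincomb w β i ≈⟨ -‿inverseʳ _ ⟩
          0#                              ∎

    ++-independentˡ : LinearlyIndependent (u ++ w) → LinearlyIndependent u
    ++-independentˡ indep γ γ≈0 = ++-independent⁻ indep γ (λ _ → 0#) (≈ᵥ.trans γ≈0 (≈ᵥ.sym (lincomb-zero w)))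

    ++-disjoint : LinearlyIndependent (u ++ w) → ∀ {v} → Span u v → Span w v → v ≈ᵥ 0ᵥ
    ++-disjoint indep (γ , v≈γ) (β , v≈β) = ≈ᵥ.trans v≈γ (≈ᵥ.trans
      (lincomb-cong (λ _ → ≈ᵥ.refl) (++-independent⁻ indep γ β (≈ᵥ.trans (≈ᵥ.sym v≈γ) v≈β)))
      (lincomb-zero u))

    ++-independent⁺ : LinearlyIndependent u → LinearlyIndependent w →
                      (∀ {v} → Span u v → Span w v → v ≈ᵥ 0ᵥ) → LinearlyIndependent (u ++ w)
    ++-independent⁺ u-indep w-indep disjoint cs cs≈0 =
      ∀-splitAt k (λ i → cs i ≈ 0#) (u-indep _ x≈0) (w-indep _ y≈0)
      where
        x y : Vect
        x = lincomb u (take k cs)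
        y = lincomb w (drop k cs)
        x+y≈0 : (x +ᵥ y) ≈ᵥ 0ᵥ
        x+y≈0 = ≈ᵥ.trans (≈ᵥ.sym (lincomb-++ u w cs)) cs≈0
        x≈0 : x ≈ᵥ 0ᵥ
        x≈0 = disjoint (take k cs , ≈ᵥ.refl) ((λ j → - drop k cs j) , λ i →
          trans (+-inverseˡ-unique _ _ (x+y≈0 i)) (sym (lincomb-neg w (drop k cs) i)))
        y≈0 : y ≈ᵥ 0ᵥ
        y≈0 i = trans (sym (+-identityˡ _)) (trans (+-congʳ (sym (x≈0 i))) (x+y≈0 i))

  Disjoint : Subspace → Subspace → Set (c ⊔ ℓ)
  Disjoint A B = ∀ {v} → mem A v → mem B v → v ≈ᵥ 0ᵥ

  module _ (A B : Subspace) (A∩B≈0 : Disjoint A B) where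

    directSum : Subspace
    directSum = span (basis A ++ basis B) (++-independent⁺ (basis-indep A) (basis-indep B)
      (λ v∈A v∈B → A∩B≈0 (Span-basis⊆mem A v∈A) (Span-basis⊆mem B v∈B)))

    directSum-isSum : IsSum directSum A B
    directSum-isSum v = mk⇔ to from
      where
        to : Span (basis A ++ basis B) v → ∃[ x ] ∃[ y ] (mem A x × mem B y × v ≈ᵥ (x +ᵥ y))
        to v∈ with Span-++⁻ v∈
        ... | x , y , x∈ , y∈ , v≈ = x , y , Span-basis⊆mem A x∈ , Span-basis⊆mem B y∈ , v≈
        from : ∃[ x ] ∃[ y ] (mem A x × mem B y × v ≈ᵥ (x +ᵥ y)) → Span (basis A ++ basis B) v
        from (x , y , x∈A , y∈B , v≈) =
          Span-resp (≈ᵥ.sym v≈) (Span-++⁺ (basis-span A x x∈A) (basis-span B y y∈B))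

  zeroSpace : Subspace
  zeroSpace = span [] (λ _ _ ())

  zeroSpace-isMeet : ∀ {A B} → Disjoint A B → IsMeet zeroSpace A B
  zeroSpace-isMeet {A} {B} A∩B≈0 v = mk⇔
    (λ (_ , v≈0) → mem-resp A (≈ᵥ.sym v≈0) (mem-0 A) , mem-resp B (≈ᵥ.sym v≈0) (mem-0 B))
    (λ (v∈A , v∈B) → [] , A∩B≈0 v∈A v∈B)

  IsSum-unique : ∀ {S S′ A B} → IsSum S A B → IsSum S′ A B → S ≅S S′
  IsSum-unique S=A+B S′=A+B = (λ v → from (S′=A+B v) ∘ to (S=A+B v)) , (λ v → from (S=A+B v) ∘ to (S′=A+B v))
    where open Equivalence

  IsSum⇒≤ˡ : ∀ {S A B} → IsSum S A B → A ≤S S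
  IsSum⇒≤ˡ {B = B} S=A+B v v∈A =
    Equivalence.from (S=A+B v) (v , 0ᵥ , v∈A , mem-0 B , λ i → sym (+-identityʳ (v i)))

  IsMeet⇒≤ˡ : ∀ {I A B} → IsMeet I A B → I ≤S A
  IsMeet⇒≤ˡ I=A∩B v = proj₁ ∘ Equivalence.to (I=A∩B v)

  IsMeet⇒≤ʳ : ∀ {I A B} → IsMeet I A B → I ≤S B
  IsMeet⇒≤ʳ I=A∩B v = proj₂ ∘ Equivalence.to (I=A∩B v)

  IsSum-absorb : ∀ {S A B C D} → IsSum A C D → D ≤S B → IsSum S C B → IsSum S A B
  IsSum-absorb {S} {A} {B} {C} {D} A=C+D D≤B S=C+B v = mk⇔ to from
    where
      to : mem S v → ∃[ a ] ∃[ b ] (mem A a × mem B b × v ≈ᵥ (a +ᵥ b))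
      to v∈S with Equivalence.to (S=C+B v) v∈S
      ... | x , b , x∈C , b∈B , v≈ = x , b , IsSum⇒≤ˡ {A} {C} {D} A=C+D x x∈C , b∈B , v≈
      from : ∃[ a ] ∃[ b ] (mem A a × mem B b × v ≈ᵥ (a +ᵥ b)) → mem S v
      from (a , b , a∈A , b∈B , v≈) with Equivalence.to (A=C+D a) a∈A
      ... | x , d , x∈C , d∈D , a≈ = Equivalence.from (S=C+B v) (x , d +ᵥ b , x∈C , mem-+ B (D≤B d d∈D) b∈B ,
        λ i → trans (v≈ i) (trans (+-congʳ (a≈ i)) (+-assoc _ _ _)))

  module DecEq (_≈?_ : Decidable _≈_) where
    open HomogeneousSystem F _≈?_ using (fewer-equations⇒nontrivial-solution)

    steinitz : ∀ {m d} {w : Fin m → Vect} {v : Fin d → Vect} →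
               LinearlyIndependent w → (∀ j → Span v (w j)) → m ℕ.≤ d
    steinitz {m} {d} {w} {v} w-indep w⊆v = decidable-stable (m ℕ.≤? d) λ m≰d →
      let (x , (j , xj≉0) , solves) = fewer-equations⇒nontrivial-solution (ℕₚ.≰⇒> m≰d) (λ k j → C j k)
          wx≈0 : lincomb w x ≈ᵥ 0ᵥ
          wx≈0 = ≈ᵥ.trans (lincomb-∘ v C (proj₂ ∘ w⊆v) x)
                          (≈ᵥ.trans (lincomb-cong (λ _ → ≈ᵥ.refl) solves) (lincomb-zero v))
      in xj≉0 (w-indep x wx≈0 j)
      where
        C : Fin m → Fin d → Carrier
        C j = proj₁ (w⊆v j)

    dim-mono : ∀ {A B} → A ≤S B → dim A ℕ.≤ dim B
    dim-mono {A} {B} A≤B = steinitz (basis-indep A) (λ j → basis-span B _ (A≤B _ (basis-mem A j)))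

    dim-cong : ∀ {A B} → A ≅S B → dim A ≡ dim B
    dim-cong {A} {B} (A≤B , B≤A) = ℕₚ.≤-antisym (dim-mono {A} {B} A≤B) (dim-mono {B} {A} B≤A)

    dim-directSum : ∀ {S A B} → IsSum S A B → Disjoint A B → dim S ≡ dim A ℕ.+ dim B
    dim-directSum {S} {A} {B} S=A+B A∩B≈0 = dim-cong {S} {directSum A B A∩B≈0}
      (IsSum-unique {S} {directSum A B A∩B≈0} {A} {B} S=A+B (directSum-isSum A B A∩B≈0))

    ∷-independent : ∀ {k} {w : Fin k → Vect} {v} → LinearlyIndependent w → ¬ Span w v → LinearlyIndependent (v ∷ w)
    ∷-independent {w = w} {v} w-indep v∉ cs cs≈0 with cs zero ≈? 0#
    ... | yes c≈0 = Fin.∀-cons c≈0 (w-indep (tail cs) tail≈0)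
      where
        tail≈0 : lincomb w (tail cs) ≈ᵥ 0ᵥ
        tail≈0 i = trans (sym (trans (+-congʳ (trans (*-congʳ c≈0) (zeroˡ (v i)))) (+-identityˡ _))) (cs≈0 i)
    ... | no c≉0 = ⊥-elim (v∉ ((λ j → - t * cs (suc j)) , v≈))
      where
        t : Carrier
        t = proj₁ (inverse (cs zero) c≉0)
        v≈ : v ≈ᵥ lincomb w (λ j → - t * cs (suc j))
        v≈ i = begin
          v i                           ≈⟨ *-identityˡ (v i) ⟨
          1# * v i                      ≈⟨ *-congʳ (trans (*-comm t (cs zero)) (proj₂ (inverse (cs zero) c≉0))) ⟨
          t * cs zero * v i             ≈⟨ *-assoc t (cs zero) (v i) ⟩
          t * (cs zero * v i)           ≈⟨ *-congˡ (+-inverseˡ-unique _ _ (cs≈0 i)) ⟩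
          t * - lincomb w (tail cs) i   ≈⟨ -‿distribʳ-* t _ ⟨
          - (t * lincomb w (tail cs) i) ≈⟨ -‿distribˡ-* t _ ⟩
          - t * lincomb w (tail cs) i   ≈⟨ lincomb-* w (- t) (tail cs) i ⟨
          lincomb w (λ j → - t * cs (suc j)) i ∎

    module FiniteScalars {q} (enum : Fin q → Carrier) (enum-onto : ∀ x → ∃[ i ] enum i ≈ x) where

      ∃-coefficients? : ∀ k {p} {Q : (Fin k → Carrier) → Set p} →
                        (∀ {xs ys} → (∀ i → xs i ≈ ys i) → Q xs → Q ys) → (∀ xs → Dec (Q xs)) → Dec (∃ Q)
      ∃-coefficients? zero Q-resp Q? = map′ ([] ,_) (λ (xs , Qxs) → Q-resp (λ ()) Qxs) (Q? [])
      ∃-coefficients? (suc k) {Q = Q} Q-resp Q? =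
        map′ (λ (i , xs , Qxs) → enum i ∷ xs , Qxs) from
             (Fin.any? λ i → ∃-coefficients? k (Q-resp ∘ ∷-cong≈) (Q? ∘ (enum i ∷_)))
        where
          ∷-cong≈ : ∀ {x} {xs ys : Fin k → Carrier} → (∀ i → xs i ≈ ys i) → ∀ i → (x ∷ xs) i ≈ (x ∷ ys) i
          ∷-cong≈ xs≈ys zero = refl
          ∷-cong≈ xs≈ys (suc i) = xs≈ys i
          from : ∃ Q → ∃[ i ] ∃[ xs ] Q (enum i ∷ xs)
          from (xs , Qxs) with enum-onto (xs zero)
          ... | i , ei≈ = i , tail xs , Q-resp (λ { zero → sym ei≈ ; (suc j) → refl }) Qxs

      Span? : ∀ {k} (w : Fin k → Vect) v → Dec (Span w v)
      Span? {k} w v = ∃-coefficients? k (λ cs≈ v≈ → ≈ᵥ.trans v≈ (lincomb-cong (λ _ → ≈ᵥ.refl) cs≈))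
                                        (λ cs → Fin.all? λ i → v i ≈? lincomb w cs i)

      mem? : ∀ A v → Dec (mem A v)
      mem? A v = map′ (Span-basis⊆mem A) (basis-span A v) (Span? (basis A) v)

      record Extension {p} (P : Vect → Set p) {m} (b : Fin m → Vect) : Set (c ⊔ ℓ ⊔ p) where
        field
          k : ℕ
          new : Fin k → Vect
          new⊆P : ∀ j → P (new j)
          independent : LinearlyIndependent (new ++ b)
          spanning : ∀ {v} → P v → Span (new ++ b) v

      extend : ∀ {p} {P : Vect → Set p} → (∀ {u v} → u ≈ᵥ v → P u → P v) → (∀ v → Dec (P v)) →
               ∀ {d} (a : Fin d → Vect) → (∀ {v} → P v → Span a v) →
               ∀ {m} {b : Fin m → Vect} → LinearlyIndependent b → (∀ j → P (b j)) → Extension P b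
      extend {P = P} P-resp P? {d} a P⊆a {m} {b} b-indep b⊆P = grow d [] (λ ()) b-indep (ℕₚ.m≤m+n d m)
        where
          -- The fuel never runs out: by steinitz, independent families inside Span a have at most d members.
          grow : ∀ fuel {k} (new : Fin k → Vect) → (∀ j → P (new j)) → LinearlyIndependent (new ++ b) →
                 d ℕ.≤ fuel ℕ.+ (k ℕ.+ m) → Extension P b
          grow fuel {k} new new⊆P indep bound
            with ∃-coefficients? d {Q = λ cs → P (lincomb a cs) × ¬ Span (new ++ b) (lincomb a cs)}
                   (λ cs≈ (P[acs] , acs∉) → let acs≈ = lincomb-cong (λ _ → ≈ᵥ.refl) cs≈
                                            in P-resp acs≈ P[acs] , acs∉ ∘ Span-resp (≈ᵥ.sym acs≈))
                   (λ cs → P? _ ×-dec ¬? (Span? _ _))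
          ... | no none = record { k = k ; new = new ; new⊆P = new⊆P ; independent = indep ; spanning = spanning }
            where
              spanning : ∀ {v} → P v → Span (new ++ b) v
              spanning {v} Pv with P⊆a Pv
              ... | cs , v≈ =
                decidable-stable (Span? _ v) λ v∉ → none (cs , P-resp v≈ Pv , v∉ ∘ Span-resp (≈ᵥ.sym v≈))
          ... | yes (cs , Pv , v∉) = adjoin fuel bound
            where
              v : Vect
              v = lincomb a cs
              indep′ : LinearlyIndependent ((v ∷ new) ++ b)
              indep′ = LinearlyIndependent-resp (≈ᵥ.reflexive ∘ ≡.sym ∘ ∷-++ v new b) (∷-independent indep v∉)
              too-many : suc k ℕ.+ m ℕ.≤ d
              too-many = steinitz indep′
                (++-all (Span a) (Fin.∀-cons {P = Span a ∘ (v ∷ new)} (P⊆a Pv) (P⊆a ∘ new⊆P)) (P⊆a ∘ b⊆P))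
              adjoin : ∀ fuel → d ℕ.≤ fuel ℕ.+ (k ℕ.+ m) → Extension P b
              adjoin zero bound = ⊥-elim (ℕₚ.<-irrefl ≡.refl (ℕₚ.<-≤-trans too-many bound))
              adjoin (suc fuel) bound = grow fuel (v ∷ new) (Fin.∀-cons {P = P ∘ (v ∷ new)} Pv new⊆P) indep′
                (ℕₚ.≤-trans bound (ℕₚ.≤-reflexive (≡.sym (ℕₚ.+-suc fuel (k ℕ.+ m)))))

      intersection : ∀ A B → ∃[ D ] IsMeet D A B
      intersection A B =
        span (new ++ []) independent , λ v → mk⇔ (λ v∈ → Span⊆mem A new⊆A v∈ , Span⊆mem B new⊆B v∈) spanning
        where
          open Extension (extend {P = λ v → mem A v × mem B v}
            (λ v≈ (v∈A , v∈B) → mem-resp A v≈ v∈A , mem-resp B v≈ v∈B) (λ v → mem? A v ×-dec mem? B v)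
            (basis A) (basis-span A _ ∘ proj₁) {b = []} (λ _ _ ()) (λ ()))
          new⊆A : ∀ j → mem A ((new ++ []) j)
          new⊆A = ++-all (mem A) (proj₁ ∘ new⊆P) (λ ())
          new⊆B : ∀ j → mem B ((new ++ []) j)
          new⊆B = ++-all (mem B) (proj₂ ∘ new⊆P) (λ ())

      complement : ∀ A B → B ≤S A → ∃[ C ] (IsSum A C B × Disjoint C B)
      complement A B B≤A =
        span new (++-independentˡ independent) , A=C+B ,
        λ v∈C v∈B → ++-disjoint independent v∈C (basis-span B _ v∈B)
        where
          open Extension (extend (mem-resp A) (mem? A) (basis A) (basis-span A _)
                                 (basis-indep B) (λ j → B≤A _ (basis-mem B j)))
          A=C+B : IsSum A (span new (++-independentˡ independent)) B
          A=C+B v = mk⇔ to from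
            where
              to : mem A v → ∃[ x ] ∃[ y ] (Span new x × mem B y × v ≈ᵥ (x +ᵥ y))
              to v∈A with Span-++⁻ (spanning v∈A)
              ... | x , y , x∈C , y∈ , v≈ = x , y , x∈C , Span-basis⊆mem B y∈ , v≈
              from : ∃[ x ] ∃[ y ] (Span new x × mem B y × v ≈ᵥ (x +ᵥ y)) → mem A v
              from (x , y , x∈C , y∈B , v≈) =
                mem-resp A (≈ᵥ.sym v≈) (mem-+ A (Span⊆mem A new⊆P x∈C) (B≤A _ y∈B))

      record SumAndMeet (A B : Subspace) : Set (Level.suc (c ⊔ ℓ)) where
        field
          sum meet : Subspace
          isSum : IsSum sum A B
          isMeet : IsMeet meet A B
          grassmann : dim A ℕ.+ dim B ≡ dim sum ℕ.+ dim meet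

      sumAndMeet : ∀ A B → SumAndMeet A B
      sumAndMeet A B with intersection A B
      ... | D , D=A∩B with complement A D (IsMeet⇒≤ˡ {D} {A} {B} D=A∩B)
      ... | C , A=C+D , C∩D≈0 = record
        { sum = directSum C B C∩B≈0
        ; meet = D
        ; isSum = IsSum-absorb {directSum C B C∩B≈0} {A} {B} {C} {D}
                    A=C+D (IsMeet⇒≤ʳ {D} {A} {B} D=A∩B) (directSum-isSum C B C∩B≈0)
        ; isMeet = D=A∩B
        ; grassmann = ≡.trans (≡.cong (ℕ._+ dim B) (dim-directSum {A} {C} {D} A=C+D C∩D≈0))
                              (xy∙z≈xz∙y (dim C) (dim D) (dim B))
        }
        where
          open import Algebra.Properties.CommutativeSemigroup ℕₚ.+-commutativeSemigroup using (xy∙z≈xz∙y)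
          C∩B≈0 : Disjoint C B
          C∩B≈0 v∈C v∈B = C∩D≈0 v∈C (Equivalence.from (D=A∩B _) (IsSum⇒≤ˡ {A} {C} {D} A=C+D _ v∈C , v∈B))

module UnionRank {c ℓ} (F : Field c ℓ) (n : ℕ) (_≈?_ : Decidable (Field._≈_ F))
                 {q} (enum : Fin q → Field.Carrier F) (enum-onto : ∀ x → ∃[ i ] Field._≈_ F (enum i) x) where
  open LinAlg F n
  open LinearAlgebra F n
  open DecEq _≈?_
  open FiniteScalars enum enum-onto
  open import Data.Nat using (_+_; _∸_; _≤_)
  open import Algebra.Properties.CommutativeSemigroup ℕₚ.+-commutativeSemigroup
    using (interchange; x∙yz≈y∙xz; xy∙z≈y∙xz)
  open ℕₚ.≤-Reasoning

  module _ (M : QMatroid) where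

    rank-gain≤dim-gain : ∀ A B → B ≤S A → r M A + dim B ≤ r M B + dim A
    rank-gain≤dim-gain A B B≤A with complement A B B≤A
    ... | C , A=C+B , C∩B≈0 = begin
      r M A + dim B                   ≤⟨ ℕₚ.+-monoˡ-≤ (dim B) (ℕₚ.m≤m+n (r M A) (r M zeroSpace)) ⟩
      (r M A + r M zeroSpace) + dim B ≤⟨ ℕₚ.+-monoˡ-≤ (dim B) (r-submod M {A} {zeroSpace} {C} {B}
                                                                   A=C+B (zeroSpace-isMeet {C} {B} C∩B≈0)) ⟩
      (r M C + r M B) + dim B         ≤⟨ ℕₚ.+-monoˡ-≤ (dim B) (ℕₚ.+-monoˡ-≤ (r M B) (r-dim M C)) ⟩
      (dim C + r M B) + dim B         ≡⟨ xy∙z≈y∙xz (dim C) (r M B) (dim B) ⟩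
      r M B + (dim C + dim B)         ≡⟨ ≡.cong (r M B +_) (dim-directSum {A} {C} {B} A=C+B C∩B≈0) ⟨
      r M B + dim A                   ∎

    independent-hereditary : ∀ A B → B ≤S A → Independent M A → Independent M B
    independent-hereditary A B B≤A A-indep = ℕₚ.≤-antisym (r-dim M B) (ℕₚ.+-cancelˡ-≤ (dim A) _ _ (begin
      dim A + dim B   ≡⟨ ≡.cong (_+ dim B) A-indep ⟨
      r M A + dim B   ≤⟨ rank-gain≤dim-gain A B B≤A ⟩
      r M B + dim A   ≡⟨ ℕₚ.+-comm (r M B) (dim A) ⟩
      dim A + r M B   ∎))

  independent⇒union-independent : ∀ M N A → Independent M A → UnionIndependent M N A
  independent⇒union-independent M N A A-indep B B≤A =
    ℕₚ.≤-trans (ℕₚ.≤-reflexive (≡.sym (independent-hereditary M A B B≤A A-indep))) (ℕₚ.m≤m+n (r M B) (r N B))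

  union-independent⇒independent : ∀ M N V → IsWhole V → IsUnionRank M N V (rk M V) →
                                  ∀ A → UnionIndependent M N A → Independent M A
  union-independent⇒independent M N V V-whole ((B₀ , B₀≤V , rank-V) , _) A A-indep =
    ℕₚ.≤-antisym (r-dim M A) (ℕₚ.+-cancelʳ-≤ (dim B₀) _ _ (ℕₚ.+-cancelˡ-≤ (r M V) _ _ (begin
      r M V + (dim A + dim B₀)              ≡⟨ ≡.cong (r M V +_) grassmann ⟩
      r M V + (dim S + dim D)               ≤⟨ ℕₚ.+-monoʳ-≤ (r M V) (ℕₚ.+-monoʳ-≤ (dim S) D-bound) ⟩
      r M V + (dim S + (r M D + r N B₀))    ≡⟨ ℕₚ.+-assoc (r M V) (dim S) _ ⟨
      (r M V + dim S) + (r M D + r N B₀)    ≤⟨ ℕₚ.+-monoˡ-≤ (r M D + r N B₀) (rank-gain≤dim-gain M V S S≤V) ⟩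
      (r M S + dim V) + (r M D + r N B₀)    ≡⟨ interchange (r M S) (dim V) (r M D) (r N B₀) ⟩
      (r M S + r M D) + (dim V + r N B₀)    ≤⟨ ℕₚ.+-monoˡ-≤ (dim V + r N B₀)
                                                 (r-submod M {S} {D} {A} {B₀} isSum isMeet) ⟩
      (r M A + r M B₀) + (dim V + r N B₀)   ≡⟨ ℕₚ.+-assoc (r M A) (r M B₀) _ ⟩
      r M A + (r M B₀ + (dim V + r N B₀))   ≡⟨ ≡.cong (r M A +_) rank-V′ ⟩
      r M A + (r M V + dim B₀)              ≡⟨ x∙yz≈y∙xz (r M A) (r M V) (dim B₀) ⟩
      r M V + (r M A + dim B₀)              ∎)))
    where
      open SumAndMeet (sumAndMeet A B₀) renaming (sum to S; meet to D)
      S≤V : S ≤S V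
      S≤V v _ = V-whole v
      D≤A : D ≤S A
      D≤A = IsMeet⇒≤ˡ {D} {A} {B₀} isMeet
      D≤B₀ : D ≤S B₀
      D≤B₀ = IsMeet⇒≤ʳ {D} {A} {B₀} isMeet
      D-bound : dim D ≤ r M D + r N B₀
      D-bound = ℕₚ.≤-trans (A-indep D D≤A) (ℕₚ.+-monoʳ-≤ (r M D) (r-mono N D≤B₀))
      rank-V′ : r M B₀ + (dim V + r N B₀) ≡ r M V + dim B₀
      rank-V′ = begin-equality
        r M B₀ + (dim V + r N B₀)                     ≡⟨ ≡.cong (r M B₀ +_) (ℕₚ.+-comm (dim V) (r N B₀)) ⟩
        r M B₀ + (r N B₀ + dim V)                     ≡⟨ ℕₚ.+-assoc (r M B₀) (r N B₀) (dim V) ⟨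
        r M B₀ + r N B₀ + dim V                       ≡⟨ ≡.cong (r M B₀ + r N B₀ +_)
                                                                 (ℕₚ.m∸n+n≡m (dim-mono {B₀} {V} B₀≤V)) ⟨
        r M B₀ + r N B₀ + (dim V ∸ dim B₀ + dim B₀)   ≡⟨ ℕₚ.+-assoc (r M B₀ + r N B₀) (dim V ∸ dim B₀) (dim B₀) ⟨
        r M B₀ + r N B₀ + (dim V ∸ dim B₀) + dim B₀   ≡⟨ ≡.cong (_+ dim B₀) rank-V ⟨
        r M V + dim B₀                                ∎

¬¬-Π-Fin : ∀ {k p} {P : Fin k → Set p} → (∀ i → ¬ ¬ P i) → ¬ ¬ (∀ i → P i)
¬¬-Π-Fin {zero} _ ¬all = ¬all λ ()
¬¬-Π-Fin {suc k} ¬¬P ¬all = ¬¬P zero λ P₀ → ¬¬-Π-Fin (¬¬P ∘ suc) λ Pₛ → ¬all (Fin.∀-cons P₀ Pₛ)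

¬¬-decidable : ∀ {c ℓ} (F : Field c ℓ) → FiniteField F → ¬ ¬ Decidable (Field._≈_ F)
¬¬-decidable F (_ , enum , enum-onto) = ¬¬-map decide (¬¬-Π-Fin λ i → ¬¬-Π-Fin λ j → ¬¬-excluded-middle)
  where
    open Field F
    decide : (∀ i j → Dec (enum i ≈ enum j)) → Decidable _≈_
    decide table x y with enum-onto x | enum-onto y
    ... | i , eᵢ≈x | j , eⱼ≈y = map′ (λ eᵢ≈eⱼ → trans (sym eᵢ≈x) (trans eᵢ≈eⱼ eⱼ≈y))
                                     (λ x≈y → trans eᵢ≈x (trans x≈y (sym eⱼ≈y))) (table i j)

proposition13 : ∀ {c ℓ : Level} (F : Field c ℓ) → FiniteField F → (n : ℕ)
    → (M N : LinAlg.QMatroid F n)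
    → (V : LinAlg.Subspace F n) → LinAlg.IsWhole F n V
    → LinAlg.IsUnionRank F n M N V (LinAlg.rk F n M V)
    → ∀ (A : LinAlg.Subspace F n)
    → (LinAlg.UnionIndependent F n M N A ⇔ LinAlg.Independent F n M A)
proposition13 F finite@(_ , enum , enum-onto) n M N V V-whole rank-V A = mk⇔
  (λ A-indep → classically (r M A ℕ.≟ dim A) λ _≈?_ →
     UnionRank.union-independent⇒independent F n _≈?_ enum enum-onto M N V V-whole rank-V A A-indep)
  (λ A-indep B B≤A → classically (dim B ℕ.≤? r M B ℕ.+ r N B) λ _≈?_ →
     UnionRank.independent⇒union-independent F n _≈?_ enum enum-onto M N A A-indep B B≤A)
  where
    open LinAlg F n
    classically : ∀ {P : Set} → Dec P → (Decidable (Field._≈_ F) → P) → P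
    classically P? prove = decidable-stable P? (¬¬-map prove (¬¬-decidable F finite))
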